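{- Assume the Axiom of Choice. Let $C$ be a class. (1) If a rubric $\mathcal R$ on $C$ generates the family $(x_m)_{m\in M}$ (i.e. this is the least $\mathcal R$-inductive family), then $\{x_m\mid m\in M\}$ is the least $\mathcal R$-inductive subset of $C$. (2) Likewise, if a broad rubric $\mathcal B$ on $C$ generates the family $(x_m)_{m\in M}$, then $\{x_m\mid m\in M\}$ is the least $\mathcal B$-inductive subset of $C$.
   Context: Ambient theory: the Base Theory (intuitionistic set theory with urelements allowed and no Foundation, with Extensionality, Inhabitation, Empty Set, Pairing, Union, Replacement, Truth Value Separation, Infinity, Exponentiation) plus the Axiom of Choice. A family within $C$ is a set $M$ with a function $M\to C$, written $(x_m)_{m\in M}$; a $K$-tuple within $C$ is a function $K\to C$. A rule $\langle K,R\rangle$ on $C$ is a set $K$ and a class function $R$ sending $K$-tuples within $C$ to families within $C$; a rubric is a family of rules $\mathcal R=(\langle K_i,R_i\rangle)_{i\in I}$. A subset $X\subseteq C$ is $\mathcal R$-inductive if for all $i\in I$, every $K_i$-tuple $[a_k]$ within $X$ with $R_i[a_k]_{k\in K_i}=(y_p)_{p\in P}$, and every $p\in P$, $y_p\in X$. A family $(x_m)_{m\in M}$ is $\mathcal R$-inductive if for all $i\in I$, $g:K_i\to M$ with $R_i[x_{g(k)}]_{k\in K_i}=(y_p)_{p\in P}$ and $p\in P$, we have $\langle i,g,p\rangle\in M$ and $x_{\langle i,g,p\rangle}=y_p$; families are ordered by inclusion ($(y_n)_{n\in N}\le(x_m)_{m\in M}$ iff $N\subseteq M$ and $y_n=x_n$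 on $N$). A broad rubric $\mathcal B$ on $C$ is a rubric $\mathcal B_0$ together with a class function $\mathcal B_1$ giving a rubric $\mathcal B_1(x)$ for each $x\in C$; $X\subseteq C$ is $\mathcal B$-inductive if it is $\mathcal B_0$-inductive and $\mathcal B_1(x)$-inductive for each $x\in X$. With $\mathrm{Basic}(i,g,p)=\langle0,\langle i,g,p\rangle\rangle$, $\mathrm{Trigger}(m,i,g,p)=\langle1,\langle m,i,g,p\rangle\rangle$, a family $(x_m)_{m\in M}$ is $\mathcal B$-inductive if: for $\mathcal B_0=(\langle K_i,R_i\rangle)_{i\in I}$, all $i$, $g:K_i\to M$ with $R_i[x_{g(k)}]=(y_p)_{p\in P}$, $p\in P$, $\mathrm{Basic}(i,g,p)\in M$ with value $y_p$; and for every $m\in M$, with $\mathcal B_1(x_m)=(\langle K_i,R_i\rangle)_{i\in I}$, all $i,g,p$ as before, $\mathrm{Trigger}(m,i,g,p)\in M$ with value $y_p$. -}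

module Defs where

-- A deep embedding of the ambient set theory (Base Theory + AC) as an
-- abstract model: a type V of objects (sets and urelements) with a
-- membership relation.  Existence axioms are stated with Σ (the usual
-- propositions-as-types reading of intuitionistic logic).  Classes are
-- Agda predicates V → Set, class functions are Agda relations that are
-- total and single-valued on their domain.

open import Level using (Level; _⊔_) renaming (suc to lsuc; zero to lzero)
open import Data.Product using (Σ; Σ-syntax; _×_; _,_)
open import Data.Sum using (_⊎_)
open import Data.Empty using (⊥)
open import Relation.Nullary using (¬_)
open import Relation.Binary.PropositionalEquality using (_≡_)

infix 2 _⇔_
_⇔_ : Set → Set → Set
A ⇔ B = (A → B) × (B → A)

record Core : Set₁ where
  infix 4 _∈_
  field
    V      : Set
    _∈_    : V → V → Set
    isSet  : V → Set
    -- Inhabitation (READING): only sets have members; the others are urelements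
    inhabitation : ∀ x y → y ∈ x → isSet x
    extensionality : ∀ a b → isSet a → isSet b → (∀ x → x ∈ a ⇔ x ∈ b) → a ≡ b
    ∅       : V
    ∅-set   : isSet ∅
    ∅-empty : ∀ x → ¬ (x ∈ ∅)
    pair     : V → V → V
    pair-set : ∀ a b → isSet (pair a b)
    pair-∈   : ∀ a b x → x ∈ pair a b ⇔ (x ≡ a ⊎ x ≡ b)
    ⋃       : V → V
    ⋃-set   : ∀ a → isSet a → isSet (⋃ a)
    ⋃-∈     : ∀ a → isSet a → ∀ x → x ∈ ⋃ a ⇔ (Σ[ y ∈ V ] (y ∈ a × x ∈ y))
    -- Replacement (schema, rendered with an arbitrary Agda relation)
    replacement : (A : V) (φ : V → V → Set) → isSet A →
      (∀ x → x ∈ A → Σ[ y ∈ V ] φ x y) →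
      (∀ x y y' → x ∈ A → φ x y → φ x y' → y ≡ y') →
      Σ[ B ∈ V ] (isSet B × (∀ y → y ∈ B ⇔ (Σ[ x ∈ V ] (x ∈ A × φ x y))))
    tv-separation : (A : V) (P : Set) → isSet A →
      Σ[ B ∈ V ] (isSet B × (∀ x → x ∈ B ⇔ (x ∈ A × P)))
  succ : V → V
  succ x = ⋃ (pair x (pair x x))
  field
    infinity : Σ[ ω ∈ V ] (isSet ω × ∅ ∈ ω × (∀ x → x ∈ ω → succ x ∈ ω))

module CoreDefs (T : Core) where
  open Core T public

  ⟨_,_⟩ : V → V → V
  ⟨ a , b ⟩ = pair (pair a a) (pair a b)

  𝟘 𝟙 : V
  𝟘 = ∅
  𝟙 = pair ∅ ∅

  IsFunTo : V → V → (V → Set) → Set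
  IsFunTo f A Q =
    isSet f ×
    (∀ z → z ∈ f → Σ[ a ∈ V ] Σ[ b ∈ V ] (a ∈ A × Q b × z ≡ ⟨ a , b ⟩)) ×
    (∀ a → a ∈ A → Σ[ b ∈ V ] (⟨ a , b ⟩ ∈ f)) ×
    (∀ a b b' → ⟨ a , b ⟩ ∈ f → ⟨ a , b' ⟩ ∈ f → b ≡ b')

  IsFunction : V → V → V → Set
  IsFunction f A B = IsFunTo f A (λ b → b ∈ B)

record BaseAC : Set₁ where
  field
    core : Core
  open CoreDefs core
  field
    exponentiation : ∀ A B → isSet A → isSet B →
      Σ[ E ∈ V ] (isSet E × (∀ f → f ∈ E ⇔ IsFunction f A B))
    choice : (A B : V) (R : V → V → Set) → isSet A → isSet B →
      (∀ a → a ∈ A → Σ[ b ∈ V ] (b ∈ B × R a b)) →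
      Σ[ f ∈ V ] (IsFunction f A B × (∀ a b → ⟨ a , b ⟩ ∈ f → R a b))

module Theory (T : BaseAC) where
  open BaseAC T using (core)
  open CoreDefs core public

  FamilyOn : V → V → (V → Set) → Set
  FamilyOn F M C = isSet M × IsFunTo F M C

  FamilyWithin : V → (V → Set) → Set
  FamilyWithin F C = Σ[ M ∈ V ] FamilyOn F M C

  -- a rubric on C: a family of rules ⟨K_i , R_i⟩ indexed by the set I
  record Rubric (C : V → Set) : Set₁ where
    field
      I     : V
      I-set : isSet I
      Ks    : V
      Ks-fam : IsFunTo Ks I isSet
      -- the class functions R_i, as a relation  R i t F  ("R_i t = F")
      R     : V → V → V → Set
      R-total  : ∀ i K → ⟨ i , K ⟩ ∈ Ks → ∀ t → IsFunTo t K C →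
                 Σ[ F ∈ V ] (R i t F × FamilyWithin F C)
      R-unique : ∀ i K t F F' → ⟨ i , K ⟩ ∈ Ks → IsFunTo t K C →
                 R i t F → R i t F' → F ≡ F'

  record BroadRubric (C : V → Set) : Set₁ where
    field
      B₀ : Rubric C
      B₁ : (x : V) → C x → Rubric C

  IsInductiveSet : {C : V → Set} → Rubric C → V → Set
  IsInductiveSet 𝓡 X =
    ∀ i K → ⟨ i , K ⟩ ∈ Ks → ∀ t → IsFunTo t K (λ a → a ∈ X) →
    ∀ F → R i t F → ∀ p y → ⟨ p , y ⟩ ∈ F → y ∈ X
    where open Rubric 𝓡

  -- t is the tuple [x_{g(k)}]_{k ∈ K}  (the composite of g with the family F)
  IsComposite : V → V → V → Set
  IsComposite t g F =
    isSet t ×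
    (∀ z → z ∈ t ⇔ (Σ[ k ∈ V ] Σ[ m ∈ V ] Σ[ v ∈ V ]
                     (z ≡ ⟨ k , v ⟩ × ⟨ k , m ⟩ ∈ g × ⟨ m , v ⟩ ∈ F)))

  -- the general closure condition of a family (x_m)_{m ∈ M} (= F) under a
  -- rubric 𝓡, with new indices tag(i,g,p)
  ClosedUnder : {C : V → Set} → Rubric C → (V → V → V → V) → V → V → Set
  ClosedUnder 𝓡 tag M F =
    ∀ i K → ⟨ i , K ⟩ ∈ Ks → ∀ g → IsFunction g K M →
    ∀ t → IsComposite t g F →
    ∀ P → R i t P → ∀ p y → ⟨ p , y ⟩ ∈ P → ⟨ tag i g p , y ⟩ ∈ F
    where open Rubric 𝓡

  triple : V → V → V → V
  triple i g p = ⟨ i , ⟨ g , p ⟩ ⟩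

  Basic : V → V → V → V
  Basic i g p = ⟨ 𝟘 , triple i g p ⟩

  Trigger : V → V → V → V → V
  Trigger m i g p = ⟨ 𝟙 , ⟨ m , triple i g p ⟩ ⟩

  IsInductiveFamily : {C : V → Set} → Rubric C → V → V → Set
  IsInductiveFamily 𝓡 M F = ClosedUnder 𝓡 triple M F

  _≤Fam_ : V → V → Set
  G ≤Fam F = ∀ n y → ⟨ n , y ⟩ ∈ G → ⟨ n , y ⟩ ∈ F

  Generates : {C : V → Set} → Rubric C → V → V → Set
  Generates {C} 𝓡 M F =
    FamilyOn F M C × IsInductiveFamily 𝓡 M F ×
    (∀ N G → FamilyOn G N C → IsInductiveFamily 𝓡 N G → F ≤Fam G)

  IsSubsetOf : V → (V → Set) → Set
  IsSubsetOf X C = isSet X × (∀ x → x ∈ X → C x)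

  IsLeastInductiveSubset : {C : V → Set} → Rubric C → V → Set
  IsLeastInductiveSubset {C} 𝓡 X =
    IsSubsetOf X C × IsInductiveSet 𝓡 X ×
    (∀ Y → IsSubsetOf Y C → IsInductiveSet 𝓡 Y → ∀ x → x ∈ X → x ∈ Y)

  IsBroadInductiveSet : {C : V → Set} → BroadRubric C → V → Set
  IsBroadInductiveSet 𝓑 X =
    IsInductiveSet B₀ X × (∀ x → x ∈ X → (c : _) → IsInductiveSet (B₁ x c) X)
    where open BroadRubric 𝓑

  IsBroadInductiveFamily : {C : V → Set} → BroadRubric C → V → V → Set
  IsBroadInductiveFamily 𝓑 M F =
    ClosedUnder B₀ Basic M F ×
    (∀ m x → ⟨ m , x ⟩ ∈ F → (c : _) → ClosedUnder (B₁ x c) (Trigger m) M F)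
    where open BroadRubric 𝓑

  GeneratesBroad : {C : V → Set} → BroadRubric C → V → V → Set
  GeneratesBroad {C} 𝓑 M F =
    FamilyOn F M C × IsBroadInductiveFamily 𝓑 M F ×
    (∀ N G → FamilyOn G N C → IsBroadInductiveFamily 𝓑 N G → F ≤Fam G)

  IsLeastBroadInductiveSubset : {C : V → Set} → BroadRubric C → V → Set
  IsLeastBroadInductiveSubset {C} 𝓑 X =
    IsSubsetOf X C × IsBroadInductiveSet 𝓑 X ×
    (∀ Y → IsSubsetOf Y C → IsBroadInductiveSet 𝓑 Y → ∀ x → x ∈ X → x ∈ Y)

  IsImage : V → V → Set
  IsImage X F = isSet X × (∀ y → y ∈ X ⇔ (Σ[ m ∈ V ] (⟨ m , y ⟩ ∈ F)))

{-# OPTIONS --safe #-}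
module Submission where

-- If a family is closed under a rule, so is its image: given a tuple drawn from
-- the image, the Axiom of Choice picks for every argument an index realising
-- it, which writes the tuple as [x_{g(k)}] for a function g into the index set.
-- Conversely, if Y is an inductive subset, restricting the family to the
-- indices whose value lies in Y gives an inductive family; by minimality the
-- generated family lies below it, so every value of the family is in Y.

open import Defs
open import Data.Product using (Σ; Σ-syntax; _×_; _,_; proj₁; proj₂)
open import Data.Sum using (_⊎_; inj₁; inj₂)
open import Relation.Binary.PropositionalEquality using (_≡_; refl; sym; trans; subst)

module Proof (T : BaseAC) where
  open BaseAC T using (choice)
  open Theory T

  ∈-pairˡ : ∀ a b → a ∈ pair a b
  ∈-pairˡ a b = proj₂ (pair-∈ a b a) (inj₁ refl)

  ∈-pairʳ : ∀ a b → b ∈ pair a b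
  ∈-pairʳ a b = proj₂ (pair-∈ a b b) (inj₂ refl)

  ∈-pair⁻ : ∀ {a b x} → x ∈ pair a b → x ≡ a ⊎ x ≡ b
  ∈-pair⁻ {a} {b} {x} = proj₁ (pair-∈ a b x)

  ∈-singleton⁻ : ∀ {a x} → x ∈ pair a a → x ≡ a
  ∈-singleton⁻ x∈ with ∈-pair⁻ x∈
  ... | inj₁ x≡a = x≡a
  ... | inj₂ x≡a = x≡a

  pair≡⇒∈ˡ : ∀ {a b c d} → pair a b ≡ pair c d → c ∈ pair a b
  pair≡⇒∈ˡ {c = c} {d} e = subst (c ∈_) (sym e) (∈-pairˡ c d)

  pair≡⇒∈ʳ : ∀ {a b c d} → pair a b ≡ pair c d → d ∈ pair a b
  pair≡⇒∈ʳ {c = c} {d} e = subst (d ∈_) (sym e) (∈-pairʳ c d)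

  ⟨,⟩-injectiveˡ : ∀ {a b c d} → ⟨ a , b ⟩ ≡ ⟨ c , d ⟩ → a ≡ c
  ⟨,⟩-injectiveˡ {a} {b} e with ∈-pair⁻ (pair≡⇒∈ˡ (sym e))
  ... | inj₁ q = sym (∈-singleton⁻ (pair≡⇒∈ˡ q))
  ... | inj₂ q = sym (∈-singleton⁻ (pair≡⇒∈ˡ q))

  ⟨,⟩-diagonal : ∀ {a b} → ⟨ a , b ⟩ ≡ ⟨ a , a ⟩ → b ≡ a
  ⟨,⟩-diagonal {a} {b} e =
    ∈-singleton⁻ (pair≡⇒∈ʳ (sym (∈-singleton⁻ (subst (pair a b ∈_) e (∈-pairʳ _ _)))))

  ⟨,⟩-injectiveʳ : ∀ {a b d} → ⟨ a , b ⟩ ≡ ⟨ a , d ⟩ → b ≡ d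
  ⟨,⟩-injectiveʳ {a} {b} {d} e with ∈-pair⁻ (pair≡⇒∈ʳ e)
  ... | inj₁ q = degenerate (∈-singleton⁻ (pair≡⇒∈ʳ (sym q)))
    where
    degenerate : d ≡ a → b ≡ d
    degenerate refl = ⟨,⟩-diagonal e
  ... | inj₂ q with ∈-pair⁻ (pair≡⇒∈ʳ (sym q))
  ...   | inj₂ d≡b = sym d≡b
  ...   | inj₁ refl = ⟨,⟩-diagonal e

  ⟨,⟩-injective : ∀ {a b c d} → ⟨ a , b ⟩ ≡ ⟨ c , d ⟩ → a ≡ c × b ≡ d
  ⟨,⟩-injective e with ⟨,⟩-injectiveˡ e
  ... | refl = refl , ⟨,⟩-injectiveʳ e

  -- {x ∈ A | P x} is ⋃ {{y ∈ {x} | P x} | x ∈ A}: only the truth value P x is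
  -- separated at each x.
  separation : (A : V) → isSet A → (P : V → Set) →
               Σ[ B ∈ V ] (isSet B × (∀ x → x ∈ B ⇔ (x ∈ A × P x)))
  separation A A-set P = ⋃ S , ⋃-set S S-set , λ x → ⇒ x , ⇐ x
    where
    piece : V → V
    piece x = proj₁ (tv-separation (pair x x) (P x) (pair-set x x))
    piece-∈ : ∀ x y → y ∈ piece x ⇔ (y ∈ pair x x × P x)
    piece-∈ x = proj₂ (proj₂ (tv-separation (pair x x) (P x) (pair-set x x)))
    pieces = replacement A (λ x w → w ≡ piece x) A-set (λ x _ → piece x , refl)
               (λ _ _ _ _ e e′ → trans e (sym e′))
    S : V
    S = proj₁ pieces
    S-set : isSet S
    S-set = proj₁ (proj₂ pieces)
    S-∈ : ∀ w → w ∈ S ⇔ (Σ[ x ∈ V ] (x ∈ A × w ≡ piece x))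
    S-∈ = proj₂ (proj₂ pieces)
    ⇒ : ∀ x → x ∈ ⋃ S → x ∈ A × P x
    ⇒ x x∈ with proj₁ (⋃-∈ S S-set x) x∈
    ... | w , w∈S , x∈w with proj₁ (S-∈ w) w∈S
    ... | x′ , x′∈A , refl with proj₁ (piece-∈ x′ x) x∈w
    ... | x∈x′ , Px′ with ∈-singleton⁻ x∈x′
    ... | refl = x′∈A , Px′
    ⇐ : ∀ x → x ∈ A × P x → x ∈ ⋃ S
    ⇐ x (x∈A , Px) = proj₂ (⋃-∈ S S-set x)
      (piece x , proj₂ (S-∈ (piece x)) (x , x∈A , refl)
               , proj₂ (piece-∈ x x) (∈-pairˡ x x , Px))

  module _ {f A : V} {Q : V → Set} (φ : IsFunTo f A Q) where

    funTo-∈ : ∀ {a b} → ⟨ a , b ⟩ ∈ f → a ∈ A × Q b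
    funTo-∈ ab∈ with proj₁ (proj₂ φ) _ ab∈
    ... | _ , _ , a∈A , Qb , e with ⟨,⟩-injective e
    ... | refl , refl = a∈A , Qb

    funTo-total : ∀ a → a ∈ A → Σ[ b ∈ V ] (⟨ a , b ⟩ ∈ f)
    funTo-total = proj₁ (proj₂ (proj₂ φ))

    funTo-unique : ∀ {a b b′} → ⟨ a , b ⟩ ∈ f → ⟨ a , b′ ⟩ ∈ f → b ≡ b′
    funTo-unique = proj₂ (proj₂ (proj₂ φ)) _ _ _

  funTo-mono : ∀ {f A} {Q Q′ : V → Set} → (∀ {b} → Q b → Q′ b) →
               IsFunTo f A Q → IsFunTo f A Q′
  funTo-mono Q⊆Q′ (f-set , graph , total , unique) =
    f-set
    , (λ z z∈ → let (a , b , a∈A , Qb , e) = graph z z∈ in a , b , a∈A , Q⊆Q′ Qb , e)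
    , total , unique

  composite-funTo : ∀ {t g F K M} {Q : V → Set} → IsFunction g K M →
                    IsFunTo F M Q → IsComposite t g F → IsFunTo t K Q
  composite-funTo {t} {g} {F} {K} {M} {Q} gφ Fφ (t-set , t-∈) = t-set , graph , total , unique
    where
    graph : ∀ z → z ∈ t → Σ[ k ∈ V ] Σ[ v ∈ V ] (k ∈ K × Q v × z ≡ ⟨ k , v ⟩)
    graph z z∈t with proj₁ (t-∈ z) z∈t
    ... | k , m , v , e , km∈g , mv∈F =
      k , v , proj₁ (funTo-∈ gφ km∈g) , proj₂ (funTo-∈ Fφ mv∈F) , e
    total : ∀ k → k ∈ K → Σ[ v ∈ V ] (⟨ k , v ⟩ ∈ t)
    total k k∈K with funTo-total gφ k k∈K
    ... | m , km∈g with funTo-total Fφ m (proj₂ (funTo-∈ gφ km∈g))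
    ... | v , mv∈F = v , proj₂ (t-∈ _) (k , m , v , refl , km∈g , mv∈F)
    unique : ∀ k v v′ → ⟨ k , v ⟩ ∈ t → ⟨ k , v′ ⟩ ∈ t → v ≡ v′
    unique k v v′ kv∈t kv′∈t with proj₁ (t-∈ _) kv∈t | proj₁ (t-∈ _) kv′∈t
    ... | _ , m , _ , e , km∈g , mv∈F | _ , m′ , _ , e′ , km′∈g , m′v′∈F
      with ⟨,⟩-injective e | ⟨,⟩-injective e′
    ... | refl , refl | refl , refl with funTo-unique gφ km∈g km′∈g
    ... | refl = funTo-unique Fφ mv∈F m′v′∈F

  module Family {C : V → Set} {M F : V} (fam : FamilyOn F M C) where

    F-fun : IsFunTo F M C
    F-fun = proj₂ fam

    image : Σ[ X ∈ V ] IsImage X F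
    image = X , X-set , λ y → (λ y∈X → let (m , _ , my∈F) = proj₁ (X-∈ y) y∈X in m , my∈F)
                            , (λ (m , my∈F) → proj₂ (X-∈ y) (m , proj₁ (funTo-∈ F-fun my∈F) , my∈F))
      where
      values = replacement M (λ m y → ⟨ m , y ⟩ ∈ F) (proj₁ fam)
                 (funTo-total F-fun) (λ _ _ _ _ → funTo-unique F-fun)
      X : V
      X = proj₁ values
      X-set : isSet X
      X-set = proj₁ (proj₂ values)
      X-∈ : ∀ y → y ∈ X ⇔ (Σ[ m ∈ V ] (m ∈ M × ⟨ m , y ⟩ ∈ F))
      X-∈ = proj₂ (proj₂ values)

    image-subset : ∀ {X} → IsImage X F → IsSubsetOf X C
    image-subset (X-set , X-∈) = X-set , λ x x∈X → proj₂ (funTo-∈ F-fun (proj₂ (proj₁ (X-∈ x) x∈X)))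

    tuple-in-image-factors : ∀ {t K X} → isSet K → IsImage X F → IsFunTo t K (_∈ X) →
                             Σ[ g ∈ V ] (IsFunction g K M × IsComposite t g F)
    tuple-in-image-factors {t} {K} K-set (_ , X-∈) tφ = g , gφ , t-set , λ z → ⇒ z , ⇐ z
      where
      Realises : V → V → Set
      Realises k m = Σ[ v ∈ V ] (⟨ k , v ⟩ ∈ t × ⟨ m , v ⟩ ∈ F)
      realisable : ∀ k → k ∈ K → Σ[ m ∈ V ] (m ∈ M × Realises k m)
      realisable k k∈K with funTo-total tφ k k∈K
      ... | v , kv∈t with proj₁ (X-∈ v) (proj₂ (funTo-∈ tφ kv∈t))
      ... | m , mv∈F = m , proj₁ (funTo-∈ F-fun mv∈F) , v , kv∈t , mv∈F
      chosen = choice K M Realises K-set (proj₁ fam) realisable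
      g : V
      g = proj₁ chosen
      gφ : IsFunction g K M
      gφ = proj₁ (proj₂ chosen)
      g-realises : ∀ k m → ⟨ k , m ⟩ ∈ g → Realises k m
      g-realises = proj₂ (proj₂ chosen)
      t-set : isSet t
      t-set = proj₁ tφ
      ⇒ : ∀ z → z ∈ t → Σ[ k ∈ V ] Σ[ m ∈ V ] Σ[ v ∈ V ]
                          (z ≡ ⟨ k , v ⟩ × ⟨ k , m ⟩ ∈ g × ⟨ m , v ⟩ ∈ F)
      ⇒ z z∈t with proj₁ (proj₂ tφ) z z∈t
      ... | k , v , k∈K , _ , refl with funTo-total gφ k k∈K
      ... | m , km∈g with g-realises k m km∈g
      ... | v′ , kv′∈t , mv′∈F with funTo-unique tφ z∈t kv′∈t
      ... | refl = k , m , v , refl , km∈g , mv′∈F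
      ⇐ : ∀ z → Σ[ k ∈ V ] Σ[ m ∈ V ] Σ[ v ∈ V ]
                  (z ≡ ⟨ k , v ⟩ × ⟨ k , m ⟩ ∈ g × ⟨ m , v ⟩ ∈ F) → z ∈ t
      ⇐ z (k , m , v , refl , km∈g , mv∈F) with g-realises k m km∈g
      ... | v′ , kv′∈t , mv′∈F with funTo-unique F-fun mv′∈F mv∈F
      ... | refl = kv′∈t

    closed⇒image-inductive : ∀ {X} (𝓡 : Rubric C) (tag : V → V → V → V) →
                             IsImage X F → ClosedUnder 𝓡 tag M F → IsInductiveSet 𝓡 X
    closed⇒image-inductive 𝓡 tag img closed i K iK t tφ P RP p y py
      with tuple-in-image-factors (proj₂ (funTo-∈ (Rubric.Ks-fam 𝓡) iK)) img tφ
    ... | g , gφ , t≡xg = proj₂ (proj₂ img y) (tag i g p , closed i K iK g gφ t t≡xg P RP p y py)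

    module Restriction (Y : V) where

      restrictedGraph = separation F (proj₁ F-fun)
                          (λ z → Σ[ m ∈ V ] Σ[ y ∈ V ] (z ≡ ⟨ m , y ⟩ × y ∈ Y))
      G : V
      G = proj₁ restrictedGraph
      G-∈ : ∀ z → z ∈ G ⇔ (z ∈ F × Σ[ m ∈ V ] Σ[ y ∈ V ] (z ≡ ⟨ m , y ⟩ × y ∈ Y))
      G-∈ = proj₂ (proj₂ restrictedGraph)

      restrictedIndices = separation M (proj₁ fam)
                            (λ m → Σ[ y ∈ V ] (⟨ m , y ⟩ ∈ F × y ∈ Y))
      N : V
      N = proj₁ restrictedIndices
      N-∈ : ∀ m → m ∈ N ⇔ (m ∈ M × Σ[ y ∈ V ] (⟨ m , y ⟩ ∈ F × y ∈ Y))
      N-∈ = proj₂ (proj₂ restrictedIndices)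

      G-intro : ∀ {m y} → ⟨ m , y ⟩ ∈ F → y ∈ Y → ⟨ m , y ⟩ ∈ G
      G-intro {m} {y} my∈F y∈Y = proj₂ (G-∈ _) (my∈F , m , y , refl , y∈Y)

      G-elim : ∀ {m y} → ⟨ m , y ⟩ ∈ G → ⟨ m , y ⟩ ∈ F × y ∈ Y
      G-elim my∈G with proj₁ (G-∈ _) my∈G
      ... | my∈F , _ , _ , e , y∈Y with ⟨,⟩-injective e
      ... | refl , refl = my∈F , y∈Y

      N⊆M : ∀ {m} → m ∈ N → m ∈ M
      N⊆M m∈N = proj₁ (proj₁ (N-∈ _) m∈N)

      value-at-N-in-Y : ∀ {m v} → m ∈ N → ⟨ m , v ⟩ ∈ F → v ∈ Y
      value-at-N-in-Y m∈N mv∈F with proj₂ (proj₁ (N-∈ _) m∈N)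
      ... | _ , my∈F , y∈Y with funTo-unique F-fun my∈F mv∈F
      ... | refl = y∈Y

      G-fun : IsFunTo G N (λ y → y ∈ Y × C y)
      G-fun = proj₁ (proj₂ restrictedGraph) , graph , total , unique
        where
        graph : ∀ z → z ∈ G → Σ[ m ∈ V ] Σ[ y ∈ V ] (m ∈ N × (y ∈ Y × C y) × z ≡ ⟨ m , y ⟩)
        graph z z∈G with proj₁ (G-∈ z) z∈G
        ... | z∈F , m , y , refl , y∈Y with funTo-∈ F-fun z∈F
        ... | m∈M , Cy = m , y , proj₂ (N-∈ m) (m∈M , y , z∈F , y∈Y) , (y∈Y , Cy) , refl
        total : ∀ m → m ∈ N → Σ[ y ∈ V ] (⟨ m , y ⟩ ∈ G)
        total m m∈N with proj₂ (proj₁ (N-∈ m) m∈N)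
        ... | y , my∈F , y∈Y = y , G-intro my∈F y∈Y
        unique : ∀ m y y′ → ⟨ m , y ⟩ ∈ G → ⟨ m , y′ ⟩ ∈ G → y ≡ y′
        unique _ _ _ my∈G my′∈G = funTo-unique F-fun (proj₁ (G-elim my∈G)) (proj₁ (G-elim my′∈G))

      restriction-family : FamilyOn G N C
      restriction-family = proj₁ (proj₂ restrictedIndices) , funTo-mono proj₂ G-fun

      composite-restriction⇒composite : ∀ {t g K} → IsFunction g K N →
                                        IsComposite t g G → IsComposite t g F
      composite-restriction⇒composite gφ (t-set , t-∈) = t-set , λ z →
        (λ z∈t → let (k , m , v , e , km∈g , mv∈G) = proj₁ (t-∈ z) z∈t
                 in k , m , v , e , km∈g , proj₁ (G-elim mv∈G))
        , λ (k , m , v , e , km∈g , mv∈F) → proj₂ (t-∈ z)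
            (k , m , v , e , km∈g , G-intro mv∈F (value-at-N-in-Y (proj₂ (funTo-∈ gφ km∈g)) mv∈F))

      restriction-closed : (𝓡 : Rubric C) (tag : V → V → V → V) → ClosedUnder 𝓡 tag M F →
                           IsInductiveSet 𝓡 Y → ClosedUnder 𝓡 tag N G
      restriction-closed 𝓡 tag closed Y-ind i K iK g gφ t t≡xg P RP p y py =
        G-intro (closed i K iK g (funTo-mono N⊆M gφ) t (composite-restriction⇒composite gφ t≡xg)
                        P RP p y py)
                (Y-ind i K iK t (funTo-mono proj₁ (composite-funTo gφ G-fun t≡xg)) P RP p y py)

      image⊆ : ∀ {X} → IsImage X F → F ≤Fam G → ∀ x → x ∈ X → x ∈ Y
      image⊆ (_ , X-∈) F≤G x x∈X = proj₂ (G-elim (F≤G _ x (proj₂ (proj₁ (X-∈ x) x∈X))))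

  generates⇒least-image : ∀ {C} (𝓡 : Rubric C) {M F} → Generates 𝓡 M F →
                          Σ[ X ∈ V ] (IsImage X F × IsLeastInductiveSubset 𝓡 X)
  generates⇒least-image {C} 𝓡 {F = F} (fam , closed , least) =
    X , img , image-subset img , closed⇒image-inductive 𝓡 triple img closed , below
    where
    open Family fam
    X : V
    X = proj₁ image
    img : IsImage X F
    img = proj₂ image
    below : ∀ Y → IsSubsetOf Y C → IsInductiveSet 𝓡 Y → ∀ x → x ∈ X → x ∈ Y
    below Y _ Y-ind = image⊆ img (least N G restriction-family (restriction-closed 𝓡 triple closed Y-ind))
      where open Restriction Y

  generatesBroad⇒least-image : ∀ {C} (𝓑 : BroadRubric C) {M F} → GeneratesBroad 𝓑 M F →
                               Σ[ X ∈ V ] (IsImage X F × IsLeastBroadInductiveSubset 𝓑 X)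
  generatesBroad⇒least-image {C} 𝓑 {F = F} (fam , (closed₀ , closed₁) , least) =
    X , img , image-subset img , (closed⇒image-inductive B₀ Basic img closed₀ , triggered) , below
    where
    open BroadRubric 𝓑
    open Family fam
    X : V
    X = proj₁ image
    img : IsImage X F
    img = proj₂ image
    triggered : ∀ x → x ∈ X → (c : C x) → IsInductiveSet (B₁ x c) X
    triggered x x∈X c with proj₁ (proj₂ img x) x∈X
    ... | m , mx∈F = closed⇒image-inductive (B₁ x c) (Trigger m) img (closed₁ m x mx∈F c)
    below : ∀ Y → IsSubsetOf Y C → IsBroadInductiveSet 𝓑 Y → ∀ x → x ∈ X → x ∈ Y
    below Y _ (Y-ind₀ , Y-ind₁) =
      image⊆ img (least N G restriction-family (restriction-closed B₀ Basic closed₀ Y-ind₀ , G-closed₁))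
      where
      open Restriction Y
      G-closed₁ : ∀ m x → ⟨ m , x ⟩ ∈ G → (c : C x) → ClosedUnder (B₁ x c) (Trigger m) N G
      G-closed₁ m x mx∈G c with G-elim mx∈G
      ... | mx∈F , x∈Y = restriction-closed (B₁ x c) (Trigger m) (closed₁ m x mx∈F c) (Y-ind₁ x x∈Y c)

proposition6p4 : (T : BaseAC) →
    let open Theory T in
    (C : V → Set) →
    ((𝓡 : Rubric C) (M F : V) → Generates 𝓡 M F →
       Σ[ X ∈ V ] (IsImage X F × IsLeastInductiveSubset 𝓡 X))
    ×
    ((𝓑 : BroadRubric C) (M F : V) → GeneratesBroad 𝓑 M F →
       Σ[ X ∈ V ] (IsImage X F × IsLeastBroadInductiveSubset 𝓑 X))
proposition6p4 T C =
  (λ 𝓡 _ _ → generates⇒least-image 𝓡) , (λ 𝓑 _ _ → generatesBroad⇒least-image 𝓑)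
  where open Proof T
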